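{- Let $c$ be a command and $f$ a label with $\mathrm{okf}(c,f)$. Then every state of the automaton $\mathrm{aut}(c,f)$ that has no successor has control point $f$; i.e., for all $n\in\mathrm{labs}(c)$ and all stores $s$ there exist $m,t$ with $(n,s)\to(m,t)$ in $\mathrm{aut}(c,f)$.
   Context: Programs: variables range over a set $\mathit{Var}$; stores are total functions $\mathit{Var}\to\mathbb{Z}$, and $s[x\mapsto v]$ is the updated store. Commands of GCL: $c::=\mathsf{skip}^n\mid x:=^n e\mid \mathsf{havoc}^n\,x\mid c;c\mid \mathsf{if}^n\,gcs\,\mathsf{fi}\mid\mathsf{do}^n\,gcs\,\mathsf{od}$, where $n\in\mathbb{Z}$ is a label and $gcs$ is a nonempty finite list of guarded commands $e\to c$ with boolean guard $e$ (boolean expressions are built from primitive boolean expressions with $\wedge,\vee,\neg$); $\llbracket e\rrbracket(s)$ is the value of $e$ in $s$, and $\mathrm{enab}(gcs)$ is the disjunction of the guards. Commands are assumed well formed: well typed, and for each subcommand $\mathsf{if}\,gcs\,\mathsf{fi}$, $\mathrm{enab}(gcs)$ is true in every store. $\mathrm{labs}(c)$ is the set of labels in $c$; $\mathrm{lab}(c)$ is the label of $c$, where $\mathrm{lab}(c;d)=\mathrm{lab}(c)$. $\mathrm{ok}(c)$: no label occurs twice in $c$ and all labels are positive; $\mathrm{okf}(c,f)$: $\mathrm{ok}(c)$ and $f\notin\mathrm{labs}(c)$. $\mathrm{sub}(n,c)$ is the subcommand of $c$ not of the form $d;d'$ whose label is $n$. Small-step semantics $\rightsquigarrow$ on configurations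 $\langle c,s\rangle$: $\langle\mathsf{havoc}^n x,s\rangle\rightsquigarrow\langle\mathsf{skip}^{ -n},s[x\mapsto v]\rangle$ for every $v\in\mathbb{Z}$; $\langle x:=^n e,s\rangle\rightsquigarrow\langle\mathsf{skip}^{ -n},s[x\mapsto\llbracket e\rrbracket(s)]\rangle$; $\langle\mathsf{skip}^n;c,s\rangle\rightsquigarrow\langle c,s\rangle$; $\langle\mathsf{if}^n gcs\,\mathsf{fi},s\rangle\rightsquigarrow\langle c,s\rangle$ if $e\to c$ is in $gcs$ and $\llbracket e\rrbracket(s)=\mathit{true}$; $\langle\mathsf{do}^n gcs\,\mathsf{od},s\rangle\rightsquigarrow\langle c;\mathsf{do}^n gcs\,\mathsf{od},s\rangle$ if $e\to c$ is in $gcs$ and $\llbracket e\rrbracket(s)=\mathit{true}$; $\langle\mathsf{do}^n gcs\,\mathsf{od},s\rangle\rightsquigarrow\langle\mathsf{skip}^{ -n},s\rangle$ if $\llbracket\mathrm{enab}(gcs)\rrbracket(s)=\mathit{false}$; and $\langle c;b,s\rangle\rightsquigarrow\langle d;b,t\rangle$ whenever $\langle c,s\rangle\rightsquigarrow\langle d,t\rangle$. Following successor, for $\mathrm{ok}(c)$, $n\in\mathrm{labs}(c)$, $f\notin\mathrm{labs}(c)$: $\mathrm{fsuc}(n,c;d,f)=\mathrm{fsuc}(n,c,\mathrm{lab}(d))$ if $n\in\mathrm{labs}(c)$, else $\mathrm{fsuc}(n,d,f)$; $\mathrm{fsuc}(n,\mathsf{if}^n gcs\,\mathsf{fi},f)=f$;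 $\mathrm{fsuc}(m,\mathsf{if}^n gcs\,\mathsf{fi},f)=\mathrm{fsuc}(m,c,f)$ if $e\to c\in gcs$ and $m\in\mathrm{labs}(c)$; $\mathrm{fsuc}(n,\mathsf{do}^n gcs\,\mathsf{od},f)=f$; $\mathrm{fsuc}(m,\mathsf{do}^n gcs\,\mathsf{od},f)=\mathrm{fsuc}(m,c,n)$ if $e\to c\in gcs$ and $m\in\mathrm{labs}(c)$; $\mathrm{fsuc}(n,\mathsf{skip}^n,f)=\mathrm{fsuc}(n,x:=^n e,f)=\mathrm{fsuc}(n,\mathsf{havoc}^n x,f)=f$. For $\mathrm{okf}(c,f)$, the automaton $\mathrm{aut}(c,f)$ has control points $\mathrm{labs}(c)\cup\{f\}$, stores $\mathit{Var}\to\mathbb{Z}$, initial control $\mathrm{lab}(c)$, final control $f$, and $(n,s)\to(m,t)$ iff either (i) $\langle\mathrm{sub}(n,c),s\rangle\rightsquigarrow\langle d,t\rangle$ for some $d$ with $\mathrm{lab}(d)>0$ and $m=\mathrm{lab}(d)$; or (ii) $\langle\mathrm{sub}(n,c),s\rangle\rightsquigarrow\langle d,t\rangle$ for some $d$ with $\mathrm{lab}(d)<0$ and $m=\mathrm{fsuc}(n,c,f)$; or (iii) $\mathrm{sub}(n,c)=\mathsf{skip}^n$, $m=\mathrm{fsuc}(n,c,f)$ and $t=s$. -}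

module Defs where

open import Data.Nat using (ℕ)
import Data.Nat as ℕ
open import Data.Integer using (ℤ; +_; -_; 0ℤ; _<_; _<?_; _≟_)
import Data.Integer as ℤ
open import Data.Bool using (Bool; true; false; _∧_; _∨_; not; if_then_else_)
open import Data.List using (List; []; _∷_; _++_)
open import Data.List.Relation.Unary.All using (All)
open import Data.List.Relation.Unary.Any using (any?)
open import Data.List.Relation.Unary.Unique.Propositional using (Unique)
open import Data.List.Membership.Propositional using (_∈_; _∉_)
open import Data.Product using (Σ; _×_; _,_)
open import Data.Sum using (_⊎_)
open import Data.Unit using (⊤)
open import Relation.Nullary using (yes; no; does)
open import Relation.Binary.PropositionalEquality using (_≡_)

Var : Set
Var = ℕ

Store : Set
Store = Var → ℤ

_[_↦_] : Store → Var → ℤ → Store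
(s [ x ↦ v ]) y = if does (y ℕ.≟ x) then v else s y

data AExp : Set where
  num  : ℤ → AExp
  var  : Var → AExp
  _⊕_  : AExp → AExp → AExp
  _⊖_  : AExp → AExp → AExp
  _⊗_  : AExp → AExp → AExp

data BExp : Set where
  btrue  : BExp
  bfalse : BExp
  _≐_    : AExp → AExp → BExp
  _≺_    : AExp → AExp → BExp
  _&&_   : BExp → BExp → BExp
  _||_   : BExp → BExp → BExp
  !_     : BExp → BExp

evalA : AExp → Store → ℤ
evalA (num k) s = k
evalA (var x) s = s x
evalA (a ⊕ b) s = evalA a s ℤ.+ evalA b s
evalA (a ⊖ b) s = evalA a s ℤ.- evalA b s
evalA (a ⊗ b) s = evalA a s ℤ.* evalA b s

evalB : BExp → Store → Bool
evalB btrue s = true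
evalB bfalse s = false
evalB (a ≐ b) s = does (evalA a s ≟ evalA b s)
evalB (a ≺ b) s = does (evalA a s <? evalA b s)
evalB (e && e') s = evalB e s ∧ evalB e' s
evalB (e || e') s = evalB e s ∨ evalB e' s
evalB (! e) s = not (evalB e s)

Label : Set
Label = ℤ

mutual
  data Cmd : Set where
    skip  : Label → Cmd
    asgn  : Label → Var → AExp → Cmd
    havoc : Label → Var → Cmd
    _⨾_   : Cmd → Cmd → Cmd
    IF    : Label → GCs → Cmd
    DO    : Label → GCs → Cmd

  data GCs : Set where
    [_⇒_]    : BExp → Cmd → GCs
    _⇒_∷_    : BExp → Cmd → GCs → GCs

data _⇒_∈G_ : BExp → Cmd → GCs → Set where
  only  : ∀ {e c} → e ⇒ c ∈G [ e ⇒ c ]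
  here  : ∀ {e c g} → e ⇒ c ∈G (e ⇒ c ∷ g)
  there : ∀ {e c e' c' g} → e ⇒ c ∈G g → e ⇒ c ∈G (e' ⇒ c' ∷ g)

enab : GCs → BExp
enab [ e ⇒ c ] = e
enab (e ⇒ c ∷ g) = e || enab g

lab : Cmd → Label
lab (skip n) = n
lab (asgn n x e) = n
lab (havoc n x) = n
lab (c ⨾ d) = lab c
lab (IF n g) = n
lab (DO n g) = n

mutual
  labs : Cmd → List Label
  labs (skip n) = n ∷ []
  labs (asgn n x e) = n ∷ []
  labs (havoc n x) = n ∷ []
  labs (c ⨾ d) = labs c ++ labs d
  labs (IF n g) = n ∷ labsG g
  labs (DO n g) = n ∷ labsG g

  labsG : GCs → List Label
  labsG [ e ⇒ c ] = labs c
  labsG (e ⇒ c ∷ g) = labs c ++ labsG g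

ok : Cmd → Set
ok c = Unique (labs c) × All (0ℤ <_) (labs c)

okf : Cmd → Label → Set
okf c f = ok c × f ∉ labs c

-- well-formedness: every if-subcommand has a guard disjunction valid in all stores
-- (well-typedness is guaranteed by the syntactic split AExp / BExp)
mutual
  WF : Cmd → Set
  WF (skip n) = ⊤
  WF (asgn n x e) = ⊤
  WF (havoc n x) = ⊤
  WF (c ⨾ d) = WF c × WF d
  WF (IF n g) = (∀ s → evalB (enab g) s ≡ true) × WFG g
  WF (DO n g) = WFG g

  WFG : GCs → Set
  WFG [ e ⇒ c ] = WF c
  WFG (e ⇒ c ∷ g) = WF c × WFG g

data _,_⇝_,_ : Cmd → Store → Cmd → Store → Set where
  st-havoc : ∀ {n x s} (v : ℤ) → havoc n x , s ⇝ skip (- n) , (s [ x ↦ v ])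
  st-asgn  : ∀ {n x e s} → asgn n x e , s ⇝ skip (- n) , (s [ x ↦ evalA e s ])
  st-skip  : ∀ {n c s} → (skip n ⨾ c) , s ⇝ c , s
  st-if    : ∀ {n g e c s} → e ⇒ c ∈G g → evalB e s ≡ true → IF n g , s ⇝ c , s
  st-do    : ∀ {n g e c s} → e ⇒ c ∈G g → evalB e s ≡ true → DO n g , s ⇝ (c ⨾ DO n g) , s
  st-exit  : ∀ {n g s} → evalB (enab g) s ≡ false → DO n g , s ⇝ skip (- n) , s
  st-seq   : ∀ {c b d s t} → c , s ⇝ d , t → (c ⨾ b) , s ⇝ (d ⨾ b) , t

data Sub : Label → Cmd → Cmd → Set where
  sub-skip  : ∀ {n} → Sub n (skip n) (skip n)
  sub-asgn  : ∀ {n x e} → Sub n (asgn n x e) (asgn n x e)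
  sub-havoc : ∀ {n x} → Sub n (havoc n x) (havoc n x)
  sub-if    : ∀ {n g} → Sub n (IF n g) (IF n g)
  sub-do    : ∀ {n g} → Sub n (DO n g) (DO n g)
  sub-seqˡ  : ∀ {n c c' d} → Sub n c d → Sub n (c ⨾ c') d
  sub-seqʳ  : ∀ {n c c' d} → Sub n c' d → Sub n (c ⨾ c') d
  sub-ifIn  : ∀ {n m g e c d} → e ⇒ c ∈G g → Sub n c d → Sub n (IF m g) d
  sub-doIn  : ∀ {n m g e c d} → e ⇒ c ∈G g → Sub n c d → Sub n (DO m g) d

-- following successor fsuc(n,c,f); total function agreeing with the paper's
-- partial definition on its domain (ok(c), n ∈ labs(c), f ∉ labs(c))
mutual
  fsuc : Label → Cmd → Label → Label
  fsuc n (c ⨾ d) f with any? (n ≟_) (labs c)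
  ... | yes _ = fsuc n c (lab d)
  ... | no  _ = fsuc n d f
  fsuc m (IF n g) f with m ≟ n
  ... | yes _ = f
  ... | no  _ = fsucG m g f
  fsuc m (DO n g) f with m ≟ n
  ... | yes _ = f
  ... | no  _ = fsucG m g n
  fsuc m (skip n) f = f
  fsuc m (asgn n x e) f = f
  fsuc m (havoc n x) f = f

  fsucG : Label → GCs → Label → Label
  fsucG m [ e ⇒ c ] f = fsuc m c f
  fsucG m (e ⇒ c ∷ g) f with any? (m ≟_) (labs c)
  ... | yes _ = fsuc m c f
  ... | no  _ = fsucG m g f

-- transition relation of aut(c,f): (n,s) → (m,t)
AutStep : Cmd → Label → Label → Store → Label → Store → Set
AutStep c f n s m t =
    (Σ Cmd λ d → Sub n c d × Σ Cmd λ d' → (d , s ⇝ d' , t) × 0ℤ < lab d' × m ≡ lab d')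
  ⊎ ((Σ Cmd λ d → Sub n c d × Σ Cmd λ d' → (d , s ⇝ d' , t) × lab d' < 0ℤ × m ≡ fsuc n c f)
  ⊎ (Sub n c (skip n) × m ≡ fsuc n c f × t ≡ s))

{-# OPTIONS --safe #-}
module Submission where

open import Defs
open import Data.Product using (Σ; _×_; _,_; proj₁; proj₂)
open import Data.List.Membership.Propositional using (_∈_)

open import Function using (id; _∘_)
open import Data.Bool using (true; false)
open import Data.Sum using (inj₁; inj₂)
open import Data.Integer using (ℤ; -_; 0ℤ; _<_)
open import Data.Integer.Properties using (neg-mono-<)
open import Data.List.Relation.Unary.All using (All; _∷_)
open import Data.List.Relation.Unary.All.Properties using (++⁻ˡ; ++⁻ʳ)
open import Data.List.Relation.Unary.Any using (here; there)
open import Data.List.Membership.Propositional.Properties using (∈-++⁻)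
open import Relation.Binary.PropositionalEquality using (_≡_; refl)

-- The subcommand sub(n,c) exists and, as a subcommand of c, is well formed
-- with positive labels.  Such a command is either a skip, which the automaton leaves by
-- rule (iii), or takes a small step.  The step ends in a skip⁻ᵏ with k > 0 (rule (ii))
-- or in a command whose label is one of the positive labels of c (rule (i)); for an if
-- the guard needed to step exists because the guards of an if cover every store.

module _ {p} {P : ℤ → Set p} where

  All-lab : ∀ c → All P (labs c) → P (lab c)
  All-lab (skip n) (pn ∷ _) = pn
  All-lab (asgn n x e) (pn ∷ _) = pn
  All-lab (havoc n x) (pn ∷ _) = pn
  All-lab (c ⨾ d) ps = All-lab c (++⁻ˡ (labs c) ps)
  All-lab (IF n g) (pn ∷ _) = pn
  All-lab (DO n g) (pn ∷ _) = pn

  ∈G-All-labs : ∀ {e c g} → e ⇒ c ∈G g → All P (labsG g) → All P (labs c)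
  ∈G-All-labs only = id
  ∈G-All-labs (here {c = c}) = ++⁻ˡ (labs c)
  ∈G-All-labs (there {c' = c'} m) = ∈G-All-labs m ∘ ++⁻ʳ (labs c')

  Sub-All-labs : ∀ {n c d} → Sub n c d → All P (labs c) → All P (labs d)
  Sub-All-labs sub-skip = id
  Sub-All-labs sub-asgn = id
  Sub-All-labs sub-havoc = id
  Sub-All-labs sub-if = id
  Sub-All-labs sub-do = id
  Sub-All-labs (sub-seqˡ sub) = Sub-All-labs sub ∘ ++⁻ˡ _
  Sub-All-labs (sub-seqʳ {c = c} sub) = Sub-All-labs sub ∘ ++⁻ʳ (labs c)
  Sub-All-labs (sub-ifIn m sub) (_ ∷ ps) = Sub-All-labs sub (∈G-All-labs m ps)
  Sub-All-labs (sub-doIn m sub) (_ ∷ ps) = Sub-All-labs sub (∈G-All-labs m ps)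

∈G-WF : ∀ {e c g} → e ⇒ c ∈G g → WFG g → WF c
∈G-WF only w = w
∈G-WF here w = proj₁ w
∈G-WF (there m) w = ∈G-WF m (proj₂ w)

Sub-WF : ∀ {n c d} → Sub n c d → WF c → WF d
Sub-WF sub-skip w = w
Sub-WF sub-asgn w = w
Sub-WF sub-havoc w = w
Sub-WF sub-if w = w
Sub-WF sub-do w = w
Sub-WF (sub-seqˡ sub) w = Sub-WF sub (proj₁ w)
Sub-WF (sub-seqʳ sub) w = Sub-WF sub (proj₂ w)
Sub-WF (sub-ifIn m sub) w = Sub-WF sub (∈G-WF m (proj₂ w))
Sub-WF (sub-doIn m sub) w = Sub-WF sub (∈G-WF m w)

Sub-lab : ∀ {n c d} → Sub n c d → lab d ≡ n
Sub-lab sub-skip = refl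
Sub-lab sub-asgn = refl
Sub-lab sub-havoc = refl
Sub-lab sub-if = refl
Sub-lab sub-do = refl
Sub-lab (sub-seqˡ sub) = Sub-lab sub
Sub-lab (sub-seqʳ sub) = Sub-lab sub
Sub-lab (sub-ifIn m sub) = Sub-lab sub
Sub-lab (sub-doIn m sub) = Sub-lab sub

mutual
  ∈-labs⇒Sub : ∀ {n} c → n ∈ labs c → Σ Cmd (Sub n c)
  ∈-labs⇒Sub (skip n) (here refl) = _ , sub-skip
  ∈-labs⇒Sub (asgn n x e) (here refl) = _ , sub-asgn
  ∈-labs⇒Sub (havoc n x) (here refl) = _ , sub-havoc
  ∈-labs⇒Sub (c ⨾ c') n∈ with ∈-++⁻ (labs c) n∈
  ... | inj₁ n∈c = let d , sub = ∈-labs⇒Sub c n∈c in d , sub-seqˡ sub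
  ... | inj₂ n∈c' = let d , sub = ∈-labs⇒Sub c' n∈c' in d , sub-seqʳ sub
  ∈-labs⇒Sub (IF n g) (here refl) = _ , sub-if
  ∈-labs⇒Sub (IF k g) (there n∈) = let d , _ , _ , m , sub = ∈-labsG⇒Sub g n∈ in d , sub-ifIn m sub
  ∈-labs⇒Sub (DO n g) (here refl) = _ , sub-do
  ∈-labs⇒Sub (DO k g) (there n∈) = let d , _ , _ , m , sub = ∈-labsG⇒Sub g n∈ in d , sub-doIn m sub

  ∈-labsG⇒Sub : ∀ {n} g → n ∈ labsG g →
    Σ Cmd λ d → Σ BExp λ e → Σ Cmd λ c → e ⇒ c ∈G g × Sub n c d
  ∈-labsG⇒Sub [ e ⇒ c ] n∈ = let d , sub = ∈-labs⇒Sub c n∈ in d , e , c , only , sub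
  ∈-labsG⇒Sub (e ⇒ c ∷ g) n∈ with ∈-++⁻ (labs c) n∈
  ... | inj₁ n∈c = let d , sub = ∈-labs⇒Sub c n∈c in d , e , c , here , sub
  ... | inj₂ n∈g = let d , e′ , c′ , m , sub = ∈-labsG⇒Sub g n∈g in d , e′ , c′ , there m , sub

enabled-guard : ∀ g s → evalB (enab g) s ≡ true →
  Σ BExp λ e → Σ Cmd λ c → e ⇒ c ∈G g × evalB e s ≡ true
enabled-guard [ e ⇒ c ] s enabled = e , c , only , enabled
enabled-guard (e ⇒ c ∷ g) s enabled with evalB e s in guard
... | true = e , c , here , guard
... | false = let e′ , c′ , m , guard′ = enabled-guard g s enabled in e′ , c′ , there m , guard′

data Progress (s : Store) : Cmd → Set where
  done : ∀ {n} → Progress s (skip n)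
  step-pos : ∀ {c d t} → c , s ⇝ d , t → 0ℤ < lab d → Progress s c
  step-neg : ∀ {c d t} → c , s ⇝ d , t → lab d < 0ℤ → Progress s c

progress : ∀ c → All (0ℤ <_) (labs c) → WF c → (s : Store) → Progress s c
progress (skip n) _ _ s = done
progress (asgn n x e) (n>0 ∷ _) _ s = step-neg st-asgn (neg-mono-< n>0)
progress (havoc n x) (n>0 ∷ _) _ s = step-neg (st-havoc 0ℤ) (neg-mono-< n>0)
progress (c ⨾ b) pos (wc , _) s with progress c (++⁻ˡ (labs c) pos) wc s
... | done = step-pos st-skip (All-lab b (++⁻ʳ (labs c) pos))
... | step-pos st d>0 = step-pos (st-seq st) d>0
... | step-neg st d<0 = step-neg (st-seq st) d<0
progress (IF n g) (_ ∷ pos) (total , _) s =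
  let _ , c , m , guard = enabled-guard g s (total s) in
  step-pos (st-if m guard) (All-lab c (∈G-All-labs m pos))
progress (DO n g) (n>0 ∷ pos) _ s with evalB (enab g) s in enabled
... | true =
  let _ , c , m , guard = enabled-guard g s enabled in
  step-pos (st-do m guard) (All-lab c (∈G-All-labs m pos))
... | false = step-neg (st-exit enabled) (neg-mono-< n>0)

lemma4p12 : (c : Cmd) (f : Label) → okf c f → WF c →
    (n : Label) → n ∈ labs c → (s : Store) →
    Σ Label λ m → Σ Store λ t → AutStep c f n s m t
lemma4p12 c f ((_ , pos) , _) wf n n∈ s
  with d , sub ← ∈-labs⇒Sub c n∈
  with progress d (Sub-All-labs sub pos) (Sub-WF sub wf) s | Sub-lab sub
... | done | refl = _ , _ , inj₂ (inj₂ (sub , refl , refl))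
... | step-pos st d>0 | _ = _ , _ , inj₁ (_ , sub , _ , st , d>0 , refl)
... | step-neg st d<0 | _ = _ , _ , inj₂ (inj₁ (_ , sub , _ , st , d<0 , refl))
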